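{- (a) For any permutation $\pi$ of length $n\ge1$, $0\le\mathrm{lpk}(\pi)\le\lfloor n/2\rfloor$; moreover, if $\mathrm{lpk}(\pi)=0$ then $\mathrm{des}(\pi)=0$, and otherwise $\mathrm{lpk}(\pi)\le\mathrm{des}(\pi)\le n-\mathrm{lpk}(\pi)$. (b) If $n\ge1$, $1\le j\le\lfloor n/2\rfloor$ and $j\le k\le n-j$, then there exists a permutation $\pi$ of length $n$ with $\mathrm{lpk}(\pi)=j$ and $\mathrm{des}(\pi)=k$. In addition, for every $n\ge1$ there exists a permutation $\pi$ of length $n$ with $\mathrm{lpk}(\pi)=\mathrm{des}(\pi)=0$.
   Context: A permutation of length $n$ is a sequence $\pi=\pi_1\cdots\pi_n$ of distinct positive integers. $\mathrm{des}(\pi)$ is the number of $i\in[n-1]$ with $\pi_i>\pi_{i+1}$. A peak is an index $2\le i\le n-1$ with $\pi_{i-1}<\pi_i>\pi_{i+1}$; a left peak is an $i\in[n-1]$ that is a peak or is $i=1$ with $\pi_1>\pi_2$; $\mathrm{lpk}(\pi)$ is the number of left peaks. -}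

module Defs where

open import Data.Nat using (ℕ; zero; suc; _+_; _<_; _<ᵇ_)
open import Data.Bool using (Bool; true; false; if_then_else_; _∧_)
open import Data.List using (List; []; _∷_; length)
open import Data.List.Relation.Unary.All using (All)
open import Data.List.Relation.Unary.Unique.Propositional using (Unique)
open import Relation.Binary.PropositionalEquality using (_≡_)
open import Data.Product using (_×_)

IsPerm : ℕ → List ℕ → Set
IsPerm n π = (length π ≡ n) × Unique π × All (λ x → 0 < x) π

[_] : Bool → ℕ
[ b ] = if b then 1 else 0

des : List ℕ → ℕ
des []            = 0
des (a ∷ [])      = 0
des (a ∷ b ∷ rest) = [ b <ᵇ a ] + des (b ∷ rest)

pk : List ℕ → ℕ
pk (a ∷ b ∷ c ∷ rest) = [ (a <ᵇ b) ∧ (c <ᵇ b) ] + pk (b ∷ c ∷ rest)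
pk _ = 0

lpk : List ℕ → ℕ
lpk (a ∷ b ∷ rest) = [ b <ᵇ a ] + pk (a ∷ b ∷ rest)
lpk _ = 0

module Submission where

-- Part (a) is proved through the descent word of π, the Boolean word whose
-- i-th letter records π_i > π_{i+1}.  The statistic des counts its true
-- letters, and, since adjacent entries are distinct, a left peak is exactly
-- the first position of a maximal run of consecutive descents, so lpk counts
-- the runs of trues.  For any Boolean word w of length m the elementary
-- bounds  runs ≤ ones,  2·runs ≤ m + 1  and  ones + runs ≤ m + 1  hold
-- (runs are separated by falses), and with m = n - 1 they give (a).
--
-- Prepending a new maximum to a
-- permutation creates one left peak at the front and one descent; prepending
-- a new minimum (shifting all other entries up) turns the left peaks into
-- peaks without changing des.  Starting from the increasing permutation,
-- alternating these operations and then prepending further maxima reaches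
-- every admissible pair (j, k).

open import Defs
open import Data.Nat using (ℕ; zero; suc; _+_; _<_; _≤_; _∸_; ⌊_/2⌋; z≤n; s≤s; z<s; _<ᵇ_)
open import Data.Nat.Properties
open import Data.Nat.Tactic.RingSolver using (solve-∀)
open import Data.Bool using (Bool; true; false; not; _∧_)
open import Data.List using (List; []; _∷_; length; map)
open import Data.List.Properties using (length-map)
open import Data.List.Relation.Unary.All using (All; []; _∷_; head) renaming (map to All-map)
import Data.List.Relation.Unary.All.Properties as All
open import Data.List.Relation.Unary.Unique.Propositional using (Unique; []; _∷_)
import Data.List.Relation.Unary.Unique.Propositional.Properties as Unique
open import Data.Product using (_×_; ∃; _,_)
open import Data.Empty using (⊥-elim)
open import Relation.Nullary.Reflects using (ofʸ; ofⁿ; det)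
open import Relation.Binary using (tri<; tri≈; tri>)
open import Relation.Binary.PropositionalEquality hiding ([_])

<ᵇ-true : ∀ {m n} → m < n → (m <ᵇ n) ≡ true
<ᵇ-true {m} {n} m<n = det (<ᵇ-reflects-< m n) (ofʸ m<n)

<ᵇ-false : ∀ {m n} → n ≤ m → (m <ᵇ n) ≡ false
<ᵇ-false {m} {n} n≤m = det (<ᵇ-reflects-< m n) (ofⁿ (≤⇒≯ n≤m))

<ᵇ-flip : ∀ {a b} → a ≢ b → (a <ᵇ b) ≡ not (b <ᵇ a)
<ᵇ-flip {a} {b} a≢b with <-cmp a b
... | tri< a<b _ _ rewrite <ᵇ-true a<b | <ᵇ-false (<⇒≤ a<b) = refl
... | tri≈ _ a≡b _ = ⊥-elim (a≢b a≡b)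
... | tri> _ _ b<a rewrite <ᵇ-true b<a | <ᵇ-false (<⇒≤ b<a) = refl

ones : List Bool → ℕ
ones []       = 0
ones (x ∷ xs) = [ x ] + ones xs

-- runs f w : number of maximal runs of trues in w, where f says whether a
-- run may begin at the first letter (the preceding letter was false or absent).
runs : Bool → List Bool → ℕ
runs f []       = 0
runs f (x ∷ xs) = [ f ∧ x ] + runs (not x) xs

-- Every run contains a true letter.
runs≤ones : ∀ f w → runs f w ≤ ones w
runs≤ones f     []           = z≤n
runs≤ones true  (true ∷ xs)  = s≤s (runs≤ones false xs)
runs≤ones false (true ∷ xs)  = m≤n⇒m≤1+n (runs≤ones false xs)
runs≤ones true  (false ∷ xs) = runs≤ones true xs
runs≤ones false (false ∷ xs) = runs≤ones true xs

runs≡0⇒ones≡0 : ∀ w → runs true w ≡ 0 → ones w ≡ 0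
runs≡0⇒ones≡0 []           _  = refl
runs≡0⇒ones≡0 (false ∷ xs) r0 = runs≡0⇒ones≡0 xs r0

-- Runs are separated by falses, so there are at most (length + 1) / 2 of them.
runs+runs≤length : ∀ f w → runs f w + runs f w ≤ [ f ] + length w
runs+runs≤length f     []           = z≤n
runs+runs≤length true  (true ∷ xs)  =
  s≤s (≤-trans (≤-reflexive (+-suc (runs false xs) (runs false xs))) (s≤s (runs+runs≤length false xs)))
runs+runs≤length false (true ∷ xs)  = m≤n⇒m≤1+n (runs+runs≤length false xs)
runs+runs≤length true  (false ∷ xs) = m≤n⇒m≤1+n (runs+runs≤length true xs)
runs+runs≤length false (false ∷ xs) = runs+runs≤length true xs

-- All runs but possibly the last are followed by a false letter.
ones+runs≤length : ∀ f w → ones w + runs f w ≤ [ f ] + length w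
ones+runs≤length f     []           = z≤n
ones+runs≤length true  (true ∷ xs)  =
  s≤s (≤-trans (≤-reflexive (+-suc (ones xs) (runs false xs))) (s≤s (ones+runs≤length false xs)))
ones+runs≤length false (true ∷ xs)  = s≤s (ones+runs≤length false xs)
ones+runs≤length true  (false ∷ xs) = m≤n⇒m≤1+n (ones+runs≤length true xs)
ones+runs≤length false (false ∷ xs) = ones+runs≤length true xs

descentWord : List ℕ → List Bool
descentWord (a ∷ b ∷ r) = (b <ᵇ a) ∷ descentWord (b ∷ r)
descentWord _           = []

length-descentWord : ∀ a r → suc (length (descentWord (a ∷ r))) ≡ length (a ∷ r)
length-descentWord a []      = refl
length-descentWord a (b ∷ r) = cong suc (length-descentWord b r)

des≡ones : ∀ π → des π ≡ ones (descentWord π)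
des≡ones []          = refl
des≡ones (a ∷ [])    = refl
des≡ones (a ∷ b ∷ r) = cong ([ b <ᵇ a ] +_) (des≡ones (b ∷ r))

-- A peak at b is a descent at b preceded by an ascent into b, i.e. the start
-- of a run of descents; distinctness makes "no descent" mean "ascent".
pk≡runs : ∀ a b r → Unique (a ∷ b ∷ r) →
          pk (a ∷ b ∷ r) ≡ runs (a <ᵇ b) (descentWord (b ∷ r))
pk≡runs a b []      _ = refl
pk≡runs a b (c ∷ r) (_ ∷ u@((b≢c ∷ _) ∷ _)) = cong ([ (a <ᵇ b) ∧ (c <ᵇ b) ] +_) (begin
  pk (b ∷ c ∷ r)                            ≡⟨ pk≡runs b c r u ⟩
  runs (b <ᵇ c) (descentWord (c ∷ r))       ≡⟨ cong (λ f → runs f (descentWord (c ∷ r))) (<ᵇ-flip b≢c) ⟩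
  runs (not (c <ᵇ b)) (descentWord (c ∷ r)) ∎)
  where open ≡-Reasoning

-- lpk counts the runs of descents; the first letter may always start one.
lpk≡runs : ∀ π → Unique π → lpk π ≡ runs true (descentWord π)
lpk≡runs []          _ = refl
lpk≡runs (a ∷ [])    _ = refl
lpk≡runs (a ∷ b ∷ r) u@((a≢b ∷ _) ∷ _) = cong ([ b <ᵇ a ] +_) (begin
  pk (a ∷ b ∷ r)                            ≡⟨ pk≡runs a b r u ⟩
  runs (a <ᵇ b) (descentWord (b ∷ r))       ≡⟨ cong (λ f → runs f (descentWord (b ∷ r))) (<ᵇ-flip a≢b) ⟩
  runs (not (b <ᵇ a)) (descentWord (b ∷ r)) ∎)
  where open ≡-Reasoning

lpk≤des : ∀ {π} → Unique π → lpk π ≤ des π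
lpk≤des {π} u = subst₂ _≤_ (sym (lpk≡runs π u)) (sym (des≡ones π)) (runs≤ones true (descentWord π))

lpk≡0⇒des≡0 : ∀ {π} → Unique π → lpk π ≡ 0 → des π ≡ 0
lpk≡0⇒des≡0 {π} u l0 =
  trans (des≡ones π) (runs≡0⇒ones≡0 (descentWord π) (trans (sym (lpk≡runs π u)) l0))

lpk+lpk≤length : ∀ {π} → Unique π → lpk π + lpk π ≤ length π
lpk+lpk≤length {[]}    _ = z≤n
lpk+lpk≤length {a ∷ r} u = begin
  lpk (a ∷ r) + lpk (a ∷ r)   ≡⟨ cong₂ _+_ e e ⟩
  runs true w + runs true w   ≤⟨ runs+runs≤length true w ⟩
  suc (length w)              ≡⟨ length-descentWord a r ⟩
  length (a ∷ r)              ∎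
  where
    open ≤-Reasoning
    w : List Bool
    w = descentWord (a ∷ r)
    e : lpk (a ∷ r) ≡ runs true w
    e = lpk≡runs (a ∷ r) u

des+lpk≤length : ∀ {π} → Unique π → des π + lpk π ≤ length π
des+lpk≤length {[]}    _ = z≤n
des+lpk≤length {a ∷ r} u = begin
  des (a ∷ r) + lpk (a ∷ r)   ≡⟨ cong₂ _+_ (des≡ones (a ∷ r)) (lpk≡runs (a ∷ r) u) ⟩
  ones w + runs true w        ≤⟨ ones+runs≤length true w ⟩
  suc (length w)              ≡⟨ length-descentWord a r ⟩
  length (a ∷ r)              ∎
  where
    open ≤-Reasoning
    w : List Bool
    w = descentWord (a ∷ r)

x+x≤n⇒x≤⌊n/2⌋ : ∀ {x n} → x + x ≤ n → x ≤ ⌊ n /2⌋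
x+x≤n⇒x≤⌊n/2⌋ {x} x+x≤n = subst (_≤ _) (sym (n≡⌊n+n/2⌋ x)) (⌊n/2⌋-mono x+x≤n)

prependMax : List ℕ → List ℕ
prependMax π = suc (length π) ∷ π

prependMin : List ℕ → List ℕ
prependMin π = 1 ∷ map suc π

des-shift : ∀ π → des (map suc π) ≡ des π
des-shift []          = refl
des-shift (a ∷ [])    = refl
des-shift (a ∷ b ∷ r) = cong ([ b <ᵇ a ] +_) (des-shift (b ∷ r))

pk-shift : ∀ π → pk (map suc π) ≡ pk π
pk-shift []              = refl
pk-shift (a ∷ [])        = refl
pk-shift (a ∷ b ∷ [])    = refl
pk-shift (a ∷ b ∷ c ∷ r) = cong ([ (a <ᵇ b) ∧ (c <ᵇ b) ] +_) (pk-shift (b ∷ c ∷ r))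

-- A larger first entry m creates a left peak at the front and a descent,
-- while the peaks stay the same (the old first entry a < m is no peak).
prepend-larger : ∀ m a r → a < m →
  lpk (m ∷ a ∷ r) ≡ suc (pk (a ∷ r)) × pk (m ∷ a ∷ r) ≡ pk (a ∷ r) × des (m ∷ a ∷ r) ≡ suc (des (a ∷ r))
prepend-larger m a []      a<m rewrite <ᵇ-true a<m = refl , refl , refl
prepend-larger m a (b ∷ r) a<m rewrite <ᵇ-true a<m | <ᵇ-false (<⇒≤ a<m) = refl , refl , refl

-- Below a new minimum the old first entry becomes an interior position, so
-- the left peaks of π become its peaks.
prepend-smaller : ∀ a r →
  lpk (prependMin (suc a ∷ r)) ≡ lpk (suc a ∷ r) × pk (prependMin (suc a ∷ r)) ≡ lpk (suc a ∷ r)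
  × des (prependMin (suc a ∷ r)) ≡ des (suc a ∷ r)
prepend-smaller a []      = refl , refl , refl
prepend-smaller a (b ∷ r) = e , e , des-shift (suc a ∷ b ∷ r)
  where
    e : [ b <ᵇ suc a ] + pk (map suc (suc a ∷ b ∷ r)) ≡ [ b <ᵇ suc a ] + pk (suc a ∷ b ∷ r)
    e = cong ([ b <ᵇ suc a ] +_) (pk-shift (suc a ∷ b ∷ r))

record Standard (π : List ℕ) : Set where
  field
    distinct : Unique π
    positive : All (λ x → 0 < x) π
    bounded  : All (_≤ length π) π
    nonempty : 1 ≤ length π

prependMax-standard : ∀ {π} → Standard π → Standard (prependMax π)
prependMax-standard s = record
  { distinct = All-map (λ x≤ e → <⇒≢ (s≤s x≤) (sym e)) bounded ∷ distinct
  ; positive = z<s ∷ positive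
  ; bounded  = ≤-refl ∷ All-map m≤n⇒m≤1+n bounded
  ; nonempty = s≤s z≤n
  }
  where open Standard s

prependMin-standard : ∀ {π} → Standard π → Standard (prependMin π)
prependMin-standard {π} s = record
  { distinct = All.map⁺ (All-map (λ 0<x e → <⇒≢ 0<x (suc-injective e)) positive)
             ∷ Unique.map⁺ suc-injective distinct
  ; positive = z<s ∷ All.map⁺ (All-map (λ _ → z<s) positive)
  ; bounded  = s≤s z≤n ∷ All.map⁺ (All-map (λ x≤ → s≤s (≤-trans x≤ (≤-reflexive (sym (length-map suc π))))) bounded)
  ; nonempty = s≤s z≤n
  }
  where open Standard s

record Shape (π : List ℕ) (n ℓ p d : ℕ) : Set where
  field
    standard : Standard π
    length≡  : length π ≡ n
    lpk≡     : lpk π ≡ ℓ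
    pk≡      : pk π ≡ p
    des≡     : des π ≡ d

prependMax-shape : ∀ {π n ℓ p d} → Shape π n ℓ p d → Shape (prependMax π) (suc n) (suc p) p (suc d)
prependMax-shape {[]}    sh = ⊥-elim (1+n≰n (Standard.nonempty (Shape.standard sh)))
prependMax-shape {a ∷ r} sh =
  let l , q , e = prepend-larger (suc (length (a ∷ r))) a r (s≤s (head (Standard.bounded standard)))
  in record
    { standard = prependMax-standard standard
    ; length≡  = cong suc length≡
    ; lpk≡     = trans l (cong suc pk≡)
    ; pk≡      = trans q pk≡
    ; des≡     = trans e (cong suc des≡)
    }
  where open Shape sh

prependMin-shape : ∀ {π n ℓ p d} → Shape π n ℓ p d → Shape (prependMin π) (suc n) ℓ ℓ d
prependMin-shape {[]}        sh = ⊥-elim (1+n≰n (Standard.nonempty (Shape.standard sh)))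
prependMin-shape {0 ∷ r}     sh with () ← head (Standard.positive (Shape.standard sh))
prependMin-shape {suc a ∷ r} sh =
  let l , q , e = prepend-smaller a r
  in record
    { standard = prependMin-standard standard
    ; length≡  = cong suc (trans (length-map suc (suc a ∷ r)) length≡)
    ; lpk≡     = trans l lpk≡
    ; pk≡      = trans q lpk≡
    ; des≡     = trans e des≡
    }
  where open Shape sh

-- ascending c = 1 2 ⋯ (c + 1)
ascending : ℕ → List ℕ
ascending zero    = 1 ∷ []
ascending (suc c) = prependMin (ascending c)

ascending-shape : ∀ c → Shape (ascending c) (suc c) 0 0 0
ascending-shape zero = record
  { standard = record { distinct = [] ∷ [] ; positive = z<s ∷ [] ; bounded = s≤s z≤n ∷ [] ; nonempty = s≤s z≤n }
  ; length≡  = refl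
  ; lpk≡     = refl
  ; pk≡      = refl
  ; des≡     = refl
  }
ascending-shape (suc c) = prependMin-shape (ascending-shape c)

-- b rounds of "new maximum, then new minimum" on top of ascending c; each
-- round adds a peak and a descent.
zigzag : ℕ → ℕ → List ℕ
zigzag zero    c = ascending c
zigzag (suc b) c = prependMin (prependMax (zigzag b c))

zigzag-shape : ∀ b c → Shape (zigzag b c) (suc (b + b + c)) b b b
zigzag-shape zero    c = ascending-shape c
zigzag-shape (suc b) c = subst (λ n → Shape (zigzag (suc b) c) n (suc b) (suc b) (suc b))
  (cong (λ t → suc (suc (t + c))) (sym (+-suc b b)))
  (prependMin-shape (prependMax-shape (zigzag-shape b c)))

-- a + 1 further maxima on top of zigzag b c: the first adds a left peak, all
-- of them add a descent.
staircase : ℕ → ℕ → ℕ → List ℕ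
staircase zero    b c = prependMax (zigzag b c)
staircase (suc a) b c = prependMax (staircase a b c)

staircase-shape : ∀ a b c → Shape (staircase a b c) (suc (suc (a + (b + b + c)))) (suc b) b (suc (a + b))
staircase-shape zero    b c = prependMax-shape (zigzag-shape b c)
staircase-shape (suc a) b c = prependMax-shape (staircase-shape a b c)

shape⇒stats : ∀ {π n ℓ p d} → Shape π n ℓ p d → IsPerm n π × lpk π ≡ ℓ × des π ≡ d
shape⇒stats sh = (length≡ , distinct , positive) , lpk≡ , des≡
  where open Shape sh; open Standard standard

-- The length and des of staircase a b c in terms of j = b + 1 and k = j + a.
staircase-length : ∀ a b c → suc (suc (a + (b + b + c))) ≡ suc b + a + suc b + c
staircase-length = solve-∀

staircase-des : ∀ a b → suc (a + b) ≡ suc b + a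
staircase-des = solve-∀

-- Every pair 1 ≤ j ≤ k with k + j ≤ n is (lpk, des) of a permutation of length n:
-- write k = j + a and n = k + j + c and take staircase a (j - 1) c.
realize : ∀ {n j k} → 1 ≤ j → j ≤ k → k + j ≤ n →
          ∃ λ (π : List ℕ) → IsPerm n π × lpk π ≡ j × des π ≡ k
realize {j = suc b} _ j≤k k+j≤n with m≤n⇒∃[o]m+o≡n j≤k
... | a , refl with m≤n⇒∃[o]m+o≡n k+j≤n
... | c , refl =
  staircase a b c
  , shape⇒stats (subst₂ (λ n d → Shape (staircase a b c) n (suc b) b d)
                        (staircase-length a b c) (staircase-des a b) (staircase-shape a b c))

lpk-des-bounds : ∀ {π} → Unique π →
    (0 ≤ lpk π × lpk π ≤ ⌊ length π /2⌋)
  × (lpk π ≡ 0 → des π ≡ 0)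
  × (lpk π ≢ 0 → lpk π ≤ des π × des π ≤ length π ∸ lpk π)
lpk-des-bounds u =
    (z≤n , x+x≤n⇒x≤⌊n/2⌋ (lpk+lpk≤length u))
  , lpk≡0⇒des≡0 u
  , λ _ → lpk≤des u , m+n≤o⇒m≤o∸n _ (des+lpk≤length u)

proposition2p6 :
    ((n : ℕ) (π : List ℕ) → 1 ≤ n → IsPerm n π →
        (0 ≤ lpk π × lpk π ≤ ⌊ n /2⌋)
      × (lpk π ≡ 0 → des π ≡ 0)
      × (lpk π ≢ 0 → lpk π ≤ des π × des π ≤ n ∸ lpk π))
    × ((n j k : ℕ) → 1 ≤ n → 1 ≤ j → j ≤ ⌊ n /2⌋ → j ≤ k → k ≤ n ∸ j →
        ∃ λ (π : List ℕ) → IsPerm n π × lpk π ≡ j × des π ≡ k)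
    × ((n : ℕ) → 1 ≤ n →
        ∃ λ (π : List ℕ) → IsPerm n π × lpk π ≡ 0 × des π ≡ 0)
proposition2p6 =
    (λ { n π _ (refl , u , _) → lpk-des-bounds u })
  , (λ n j k _ 1≤j j≤n/2 j≤k k≤n∸j →
       realize 1≤j j≤k (m≤o∸n⇒m+n≤o k (≤-trans j≤n/2 (⌊n/2⌋≤n n)) k≤n∸j))
  , λ { (suc c) _ → ascending c , shape⇒stats (ascending-shape c) }
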